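{- Let $G$ be a finite connected graph with a universal vertex. If there exists $v \in V(G)$ with $\deg(v) \leq 3$, then $c_H(G) \leq 2$.
   Context: A universal vertex is one adjacent to all other vertices. Hyperopic Cops and Robber on $G$ (each vertex considered to carry a loop, so a player may stay put): the cops first occupy a multiset of vertices, then the robber chooses a vertex. In each round, each cop moves to an adjacent vertex or stays, then the robber moves to an adjacent vertex or stays. The robber always sees all cops. The cops see the robber's position except when the robber's vertex is adjacent to every vertex occupied by a cop, in which case the robber is invisible. The robber is captured when a cop occupies the robber's vertex. $c_H(G)$ is the minimum number of cops that can guarantee capture in finitely many moves. -}

module Defs where

open import Data.Nat using (ℕ; zero; suc; _≤_; _+_)
open import Data.Fin using (Fin; _≟_)
open import Data.Bool using (Bool; true; false; _∨_; _∧_; not; if_then_else_)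
open import Data.Maybe using (Maybe; just; nothing)
open import Data.List using (List; []; _∷_)
open import Data.Vec using (tabulate)
import Data.Vec as Vec
open import Data.Product using (Σ; ∃; _×_; _,_; proj₁; proj₂)
open import Data.Sum using (_⊎_)
open import Relation.Binary.PropositionalEquality using (_≡_)
open import Relation.Nullary.Decidable using (⌊_⌋)

record Graph (n : ℕ) : Set where
  field
    adj     : Fin n → Fin n → Bool
    symm    : ∀ u v → adj u v ≡ adj v u
    irrefl  : ∀ v → adj v v ≡ false
open Graph public

module _ {n : ℕ} (G : Graph n) where

  data Reachable : Fin n → Fin n → Set where
    here : ∀ {u} → Reachable u u
    step : ∀ {u v w} → adj G u v ≡ true → Reachable v w → Reachable u w

  Connected : Set
  Connected = ∀ u v → Reachable u v

  Universal : Fin n → Set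
  Universal u = ∀ v → ¬≡ u v → adj G u v ≡ true
    where
      open import Relation.Nullary using (¬_)
      ¬≡ : Fin n → Fin n → Set
      ¬≡ a b = ¬ (a ≡ b)

  HasUniversalVertex : Set
  HasUniversalVertex = ∃ λ u → Universal u

  degree : Fin n → ℕ
  degree v = Vec.sum (tabulate λ w → if adj G v w then 1 else 0)

  -- closed adjacency (every vertex carries a loop): adjacent or equal
  cadj : Fin n → Fin n → Bool
  cadj a b = adj G a b ∨ ⌊ a ≟ b ⌋

  CAdj : Fin n → Fin n → Set
  CAdj a b = cadj a b ≡ true

allFin? : ∀ {k} → (Fin k → Bool) → Bool
allFin? {zero}  f = true
allFin? {suc k} f = f Fin.zero ∧ allFin? (λ i → f (Fin.suc i))
  where import Data.Fin as Fin

module Game {n : ℕ} (G : Graph n) (k : ℕ) where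

  -- positions of the k cops (a multiset of vertices, as a labelled family)
  Cops : Set
  Cops = Fin k → Fin n

  invisible : Cops → Fin n → Bool
  invisible c r = allFin? (λ i → cadj G (c i) r)

  observe : Cops → Fin n → Maybe (Fin n)
  observe c r = if invisible c r then nothing else just r

  -- A cop strategy: initial placement, and a move rule depending on the
  -- history of observations (newest first) and current cop positions.
  -- Each cop must move to an adjacent vertex or stay.
  record Strategy : Set where
    field
      init  : Cops
      move  : List (Maybe (Fin n)) → Cops → Cops
      legal : ∀ h c i → CAdj G (c i) (move h c i)
  open Strategy public

  -- A robber play: robber's vertex after round t (t = 0: initial choice).
  LegalRobber : (ℕ → Fin n) → Set
  LegalRobber r = ∀ t → CAdj G (r t) (r (suc t))

  -- In round t+1 the cops move (and observe the robber at r t), then the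
  -- robber moves to r (t+1) (and is observed again).
  state : Strategy → (ℕ → Fin n) → ℕ → Cops × List (Maybe (Fin n))
  state σ r zero = init σ , (observe (init σ) (r zero) ∷ [])
  state σ r (suc t) with state σ r t
  ... | c , h = c' , (observe c' (r (suc t)) ∷ observe c' (r t) ∷ h)
    where c' = move σ h c

  copsAt : Strategy → (ℕ → Fin n) → ℕ → Cops
  copsAt σ r t = proj₁ (state σ r t)

  -- capture: some cop is on the robber's vertex, either at the end of
  -- round t, or right after the cops' move in round t+1
  Captured : Strategy → (ℕ → Fin n) → Set
  Captured σ r = ∃ λ t → ∃ λ i →
    (copsAt σ r t i ≡ r t) ⊎ (copsAt σ r (suc t) i ≡ r t)

  CopsWin : Set
  CopsWin = Σ Strategy λ σ → ∀ r → LegalRobber r → Captured σ r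

cH≤ : ∀ {n} → Graph n → ℕ → Set
cH≤ G m = ∃ λ k → k ≤ m × Game.CopsWin G k

-- Put one cop on the universal vertex u and the other on a vertex w whose
-- neighbourhood lies in {u, a, b}; such a w exists as soon as some vertex has
-- degree at most 3. A robber avoiding both cops either is not adjacent to w,
-- hence visible, and the cop on u steps onto him; or is adjacent to both cops,
-- hence invisible but at a or b, and the cops step onto a and b.
module Submission where

open import Defs
open import Data.Nat using (ℕ; _≤_)
open import Data.Fin using (Fin)
open import Data.Product using (∃)

open import Function using (id; _∘_)
open import Data.Nat using (suc; z≤n; s≤s; s≤s⁻¹)
open import Data.Fin using (zero; suc; _≟_)
open import Data.Bool using (Bool; true; false; _∧_; if_then_else_)
open import Data.Bool.Properties using (∨-zeroʳ)
open import Data.Maybe using (Maybe; just; nothing)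
open import Data.List using (List; []; _∷_; length; map)
open import Data.List.Properties using (length-map)
open import Data.List.Membership.Propositional using (_∈_)
open import Data.List.Membership.Propositional.Properties using (∈-map⁺; ∉[])
open import Data.List.Relation.Binary.Subset.Propositional using (_⊆_)
open import Data.List.Relation.Unary.Any using (here; there)
open import Data.Product using (∃₂; _×_; _,_)
open import Data.Sum using (inj₁; inj₂)
open import Data.Empty using (⊥-elim)
open import Relation.Nullary using (yes; no)
open import Relation.Binary.PropositionalEquality
  using (_≡_; _≢_; refl; sym; trans; cong; cong₂; subst)
import Data.Vec as Vec

∈⇒⊆-∷ : ∀ {A : Set} {x : A} {xs : List A} → x ∈ xs →
  ∃ λ ys → suc (length ys) ≡ length xs × xs ⊆ x ∷ ys
∈⇒⊆-∷ {xs = _ ∷ ys} (here refl) = ys , refl , id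
∈⇒⊆-∷ {xs = y ∷ _} (there x∈xs) with ∈⇒⊆-∷ x∈xs
... | ys , len , xs⊆ = y ∷ ys , cong suc len , λ
  { (here refl) → there (here refl)
  ; (there z∈xs) → skip (xs⊆ z∈xs) }
  where
    skip : ∀ {z} → z ∈ _ ∷ ys → z ∈ _ ∷ y ∷ ys
    skip (here z≡x) = here z≡x
    skip (there z∈ys) = there (there z∈ys)

-- The default element only serves to pad lists shorter than two.
⊆-pair : ∀ {A : Set} (d : A) (xs : List A) → length xs ≤ 2 →
  ∃₂ λ a b → xs ⊆ a ∷ b ∷ []
⊆-pair d [] _ = d , d , λ ()
⊆-pair d (a ∷ []) _ = a , d , λ { (here refl) → here refl }
⊆-pair d (a ∷ b ∷ []) _ = a , b , id
⊆-pair d (_ ∷ _ ∷ _ ∷ _) (s≤s (s≤s ()))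

false≢true : false ≢ true
false≢true ()

countTrue : ∀ {n} → (Fin n → Bool) → ℕ
countTrue f = Vec.sum (Vec.tabulate λ x → if f x then 1 else 0)

true-cover : ∀ {n} (f : Fin n → Bool) →
  ∃ λ xs → length xs ≡ countTrue f × (∀ x → f x ≡ true → x ∈ xs)
true-cover {ℕ.zero} f = [] , refl , λ ()
true-cover {suc n} f with true-cover (f ∘ suc) | f zero in f0
... | xs , len , cover | true =
  zero ∷ map suc xs , cong suc (trans (length-map suc xs) len) , λ
    { zero _ → here refl
    ; (suc x) fx → there (∈-map⁺ suc (cover x fx)) }
... | xs , len , cover | false =
  map suc xs , trans (length-map suc xs) len , λ
    { zero fz → ⊥-elim (false≢true (trans (sym f0) fz))
    ; (suc x) fx → ∈-map⁺ suc (cover x fx) }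

module _ {n : ℕ} (G : Graph n) where

  NeighboursWithin : Fin n → List (Fin n) → Set
  NeighboursWithin w xs = ∀ x → adj G w x ≡ true → x ∈ xs

  neighbour-list : ∀ v → ∃ λ xs → length xs ≡ degree G v × NeighboursWithin v xs
  neighbour-list v = true-cover (adj G v)

  cadj-refl : ∀ a → CAdj G a a
  cadj-refl a with a ≟ a
  ... | yes _ = ∨-zeroʳ (adj G a a)
  ... | no a≢a = ⊥-elim (a≢a refl)

  adj⇒cadj : ∀ {a b} → adj G a b ≡ true → CAdj G a b
  adj⇒cadj {a} {b} ab rewrite ab = refl

  cadj⇒adj : ∀ {a b} → a ≢ b → CAdj G a b → adj G a b ≡ true
  cadj⇒adj {a} {b} a≢b ab with adj G a b | a ≟ b
  ... | true  | _ = refl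
  ... | false | yes a≡b = ⊥-elim (a≢b a≡b)
  ... | false | no _ = ab

  module _ {u : Fin n} (univ : Universal G u) where

    adj-universal : ∀ {x} → x ≢ u → adj G u x ≡ true
    adj-universal x≢u = univ _ (x≢u ∘ sym)

    cadj-universal : ∀ x → CAdj G u x
    cadj-universal x with x ≟ u
    ... | yes refl = cadj-refl u
    ... | no x≢u = adj⇒cadj (adj-universal x≢u)

    NeighboursWithinUniversalAndPair : Set
    NeighboursWithinUniversalAndPair =
      ∃ λ w → ∃₂ λ a b → NeighboursWithin w (u ∷ a ∷ b ∷ [])

    nonuniversal-low-degree⇒neighboursWithin : ∀ {v} → v ≢ u → degree G v ≤ 3 →
      NeighboursWithinUniversalAndPair
    nonuniversal-low-degree⇒neighboursWithin {v} v≢u deg≤3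
      with neighbour-list v
    ... | xs , len , nbrs
      with ∈⇒⊆-∷ (nbrs u (trans (symm G v u) (adj-universal v≢u)))
    ... | ys , len′ , xs⊆
      with ⊆-pair u ys (s≤s⁻¹ (subst (_≤ 3) (trans (sym len) (sym len′)) deg≤3))
    ... | a , b , ys⊆ = v , a , b , λ x vx → widen (xs⊆ (nbrs x vx))
      where
        widen : ∀ {x} → x ∈ u ∷ ys → x ∈ u ∷ a ∷ b ∷ []
        widen (here x≡u) = here x≡u
        widen (there x∈ys) = there (ys⊆ x∈ys)

    -- Every vertex other than u is a neighbour of u, so a neighbour p of u
    -- has all its own neighbours among u and the other neighbours of u.
    universal-low-degree⇒neighboursWithin : degree G u ≤ 3 →
      NeighboursWithinUniversalAndPair
    universal-low-degree⇒neighboursWithin deg≤3 with neighbour-list u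
    ... | [] , _ , nbrs = u , u , u , λ x ux → ⊥-elim (∉[] (nbrs x ux))
    ... | p ∷ ys , len , nbrs
      with ⊆-pair u ys (s≤s⁻¹ (subst (_≤ 3) (sym len) deg≤3))
    ... | a , b , ys⊆ = p , a , b , within
      where
        within : NeighboursWithin p (u ∷ a ∷ b ∷ [])
        within x px with x ≟ u
        ... | yes x≡u = here x≡u
        ... | no x≢u with nbrs x (adj-universal x≢u)
        ...   | here refl = ⊥-elim (false≢true (trans (sym (irrefl G x)) px))
        ...   | there x∈ys = there (ys⊆ x∈ys)

    low-degree⇒neighboursWithin : ∀ v → degree G v ≤ 3 →
      NeighboursWithinUniversalAndPair
    low-degree⇒neighboursWithin v deg≤3 with v ≟ u
    ... | yes refl = universal-low-degree⇒neighboursWithin deg≤3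
    ... | no v≢u = nonuniversal-low-degree⇒neighboursWithin v≢u deg≤3

    module TwoCopStrategy (w a b : Fin n) where
      open Game G 2

      start : Cops
      start zero = u
      start (suc _) = w

      target : List (Maybe (Fin n)) → Fin 2 → Fin n
      target _ (suc _) = b
      target (just x ∷ _) zero = x
      target _ zero = a

      advance : List (Maybe (Fin n)) → Cops → Cops
      advance h c i = if cadj G (c i) (target h i) then target h i else c i

      advance-legal : ∀ h c i → CAdj G (c i) (advance h c i)
      advance-legal h c i with cadj G (c i) (target h i) in reach
      ... | true = reach
      ... | false = cadj-refl (c i)

      strategy : Strategy
      strategy = record { init = start ; move = advance ; legal = advance-legal }

      advance-to : ∀ h c i {x} → target h i ≡ x → CAdj G (c i) x → advance h c i ≡ x
      advance-to h c i refl reach rewrite reach = refl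

      firstStep : Fin n → Cops
      firstStep x = advance (observe start x ∷ []) start

      firstStep-seen : ∀ x → cadj G w x ≡ false → firstStep x zero ≡ x
      firstStep-seen x wx = advance-to (observe start x ∷ []) start zero
        (cong (λ o → target (o ∷ []) zero) observe-just) (cadj-universal x)
        where
          observe-just : observe start x ≡ just x
          observe-just =
            cong₂ (λ p q → if p ∧ (q ∧ true) then nothing else just x) (cadj-universal x) wx

      firstStep-hidden : ∀ x → CAdj G w x → firstStep x zero ≡ a
      firstStep-hidden x wx = advance-to (observe start x ∷ []) start zero
        (cong (λ o → target (o ∷ []) zero) observe-nothing) (cadj-universal a)
        where
          observe-nothing : observe start x ≡ nothing
          observe-nothing =
            cong₂ (λ p q → if p ∧ (q ∧ true) then nothing else just x) (cadj-universal x) wx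

      firstStep-b : ∀ x → CAdj G w b → firstStep x (suc zero) ≡ b
      firstStep-b x = advance-to (observe start x ∷ []) start (suc zero) refl

    two-cops-win : NeighboursWithinUniversalAndPair → Game.CopsWin G 2
    two-cops-win (w , a , b , nbrs) = strategy , capture
      where
        open TwoCopStrategy w a b
        open Game G 2 using (LegalRobber; Captured)

        capture : ∀ r → LegalRobber r → Captured strategy r
        capture r _ with r 0 ≟ u | r 0 ≟ w
        ... | yes r≡u | _ = 0 , zero , inj₁ (sym r≡u)
        ... | no _ | yes r≡w = 0 , suc zero , inj₁ (sym r≡w)
        ... | no r≢u | no r≢w with cadj G w (r 0) in wr
        ... | false = 0 , zero , inj₂ (firstStep-seen (r 0) wr)
        ... | true with nbrs (r 0) (cadj⇒adj (r≢w ∘ sym) wr)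
        ... | here r≡u = ⊥-elim (r≢u r≡u)
        ... | there (here r≡a) =
          0 , zero , inj₂ (trans (firstStep-hidden (r 0) wr) (sym r≡a))
        ... | there (there (here r≡b)) =
          0 , suc zero , inj₂ (trans (firstStep-b (r 0) (subst (CAdj G w) r≡b wr)) (sym r≡b))

corollary3p5 : ∀ (n : ℕ) (G : Graph n) → Connected G → HasUniversalVertex G
    → (∃ λ (v : Fin n) → degree G v ≤ 3) → cH≤ G 2
corollary3p5 n G _ (u , univ) (v , deg≤3) =
  2 , s≤s (s≤s z≤n) , two-cops-win G univ (low-degree⇒neighboursWithin G univ v deg≤3)
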